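{- For every positive integer $n$, $$\sum_{\substack{\pi\in\mathfrak{S}_n\\ \pi\ \text{cyclically } 123\text{ -avoiding}}} 2^{\mathbf{bb}^c(\pi)} = n!.$$
   Context: A permutation $\pi\in\mathfrak{S}_n$ is cyclically $123$-avoiding if there is no index $1\le i\le n$ with $\pi_i<\pi_{i+1}<\pi_{i+2}$ (indices modulo $n$), i.e. it has no cyclic double ascent. The number of cyclic double descents is $\mathbf{bb}^c(\pi)=\#\{i\in\{1,\ldots,n\}: \pi_i>\pi_{i+1}>\pi_{i+2}\}$, indices modulo $n$. -}

module Defs where

open import Data.Nat using (ℕ; zero; suc; _+_; _^_; NonZero)
open import Data.Nat.DivMod using (_mod_)
open import Data.Fin using (Fin; zero; suc; toℕ; _<_; _≟_)
open import Data.Fin.Properties using (all?; any?; _<?_)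
open import Data.List using (List; []; _∷_; map; concatMap; filter; allFin)
open import Data.Nat.ListAction using (sum)
open import Data.Product using (∃; _×_; _,_)
open import Relation.Binary.PropositionalEquality using (_≡_)
open import Relation.Nullary using (Dec; yes; no; ¬_; does)
open import Relation.Nullary.Decidable using (_×-dec_; _→-dec_; ¬?)
open import Data.Bool using (Bool; true; false; if_then_else_)

allFuns : (n m : ℕ) → List (Fin n → Fin m)
allFuns zero    m = (λ ()) ∷ []
allFuns (suc n) m =
  concatMap (λ a → map (λ f → λ { zero → a ; (suc i) → f i }) (allFuns n m)) (allFin m)

IsPerm : {n : ℕ} → (Fin n → Fin n) → Set
IsPerm {n} π = (∀ i j → π i ≡ π j → i ≡ j) × (∀ y → ∃ λ x → π x ≡ y)

isPerm? : {n : ℕ} (π : Fin n → Fin n) → Dec (IsPerm π)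
isPerm? π = all? (λ i → all? (λ j → (π i ≟ π j) →-dec (i ≟ j)))
            ×-dec all? (λ y → any? (λ x → π x ≟ y))

csuc : {n : ℕ} .{{_ : NonZero n}} → Fin n → Fin n
csuc {n} i = (suc (toℕ i)) mod n

CycDoubleAscentAt : {n : ℕ} .{{_ : NonZero n}} → (Fin n → Fin n) → Fin n → Set
CycDoubleAscentAt π i = (π i < π (csuc i)) × (π (csuc i) < π (csuc (csuc i)))

CycDoubleDescentAt : {n : ℕ} .{{_ : NonZero n}} → (Fin n → Fin n) → Fin n → Set
CycDoubleDescentAt π i = (π (csuc i) < π i) × (π (csuc (csuc i)) < π (csuc i))

Cyclically123Avoiding : {n : ℕ} .{{_ : NonZero n}} → (Fin n → Fin n) → Set
Cyclically123Avoiding π = ∀ i → ¬ CycDoubleAscentAt π i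

cyc123Avoiding? : {n : ℕ} .{{_ : NonZero n}} (π : Fin n → Fin n) → Dec (Cyclically123Avoiding π)
cyc123Avoiding? π = all? (λ i → ¬? ((π i <? π (csuc i)) ×-dec (π (csuc i) <? π (csuc (csuc i)))))

bbc : {n : ℕ} .{{_ : NonZero n}} → (Fin n → Fin n) → ℕ
bbc π = sum (map (λ i → if does ((π (csuc i) <? π i) ×-dec (π (csuc (csuc i)) <? π (csuc i))) then 1 else 0)
                 (allFin _))

perms : (n : ℕ) → List (Fin n → Fin n)
perms n = filter isPerm? (allFuns n n)

cycSum : (n : ℕ) .{{_ : NonZero n}} → ℕ
cycSum n = sum (map (λ π → 2 ^ bbc π) (filter cyc123Avoiding? (perms n)))

-- Write π in one-line notation u. Rotating u does not change its cyclic weight, so the sum is n times the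
-- sum over the words M u, with M = n - 1 the maximum and u a permutation of {0, …, M - 1}. Because M is a
-- peak, the cyclic windows of M u are the windows of M u M, i.e. of u framed by +∞ on both sides, and the
-- summand becomes 2 ^ y(u) if x(u) = 0 and 0 otherwise, where x and y count double ascents and double
-- descents of +∞ u +∞. Valley hopping (the modified Foata–Strehl action) flips double ascents and double
-- descents independently, keeping the peaks p and x + y; each orbit has 2 ^ (x + y) elements, exactly one
-- of them without double ascents. Hence Σ_u [x = 0] 2 ^ y φ(p, y) = Σ_u φ(p, x + y) for every φ, and
-- φ = 1 gives M!. This identity is proved by induction on M, inserting a new maximum into every position
-- (the operator Φ below), together with the symmetry Σ_u x · G(p, x - 1, y) = Σ_u y · G(p, x, y - 1).

module Submission where

open import Defs
open import Data.Bool using (Bool; true; false; if_then_else_; not; _∧_)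
import Data.Bool.Properties as Bool
open import Data.Empty using (⊥-elim)
open import Data.Fin using (Fin; toℕ; fromℕ<)
import Data.Fin.Properties as Fin
open import Data.List using (List; []; _∷_; _++_; [_]; _∷ʳ_; map; concatMap; filter; length; take; upTo; applyUpTo; tabulate; allFin)
import Data.List.Properties as List
open import Data.List.Membership.Propositional using (_∈_; _∉_; find; lose)
import Data.List.Membership.Propositional.Properties as ∈
open import Data.List.Membership.Propositional.Properties.WithK using (unique∧set⇒bag)
open import Data.List.Relation.Binary.BagAndSetEquality using (∼bag⇒↭)
import Data.List.Relation.Binary.Permutation.Propositional.Properties as ↭ₚ
open import Data.List.Relation.Binary.Pointwise using (Pointwise; []; _∷_)
open import Data.List.Relation.Unary.All as All using (All; []; _∷_)
import Data.List.Relation.Unary.All.Properties as Allₚ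
open import Data.List.Relation.Unary.Any using (here; there)
open import Data.List.Relation.Unary.Linked using (Linked; []; [-]; _∷_)
open import Data.List.Relation.Unary.Linked.Properties using (AllPairs⇒Linked)
open import Data.List.Relation.Unary.Unique.Propositional using (Unique; []; _∷_)
import Data.List.Relation.Unary.Unique.Propositional.Properties as Unique
open import Data.Nat using (ℕ; zero; suc; _+_; _*_; _∸_; _^_; _<_; _≤_; _<?_; _≟_; _≡ᵇ_; _!; pred; NonZero; s≤s; z≤n)
import Data.Nat.Properties as ℕ
open import Algebra.Properties.CommutativeSemigroup ℕ.+-commutativeSemigroup using (interchange; x∙yz≈y∙xz)
open import Data.Nat.DivMod using (_%_; _mod_; %-distribˡ-+; m%n%n≡m%n; m<n⇒m%n≡m; n%n≡0; [m+n]%n≡m%n)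
open import Data.Nat.ListAction using (sum)
open import Data.Nat.ListAction.Properties using (sum-++; sum-↭)
open import Data.Nat.Tactic.RingSolver using (solve-∀)
open import Data.List.Membership.DecPropositional _≟_ using (_∈?_)
open import Data.List.Relation.Unary.Unique.DecPropositional _≟_ using (unique?)
open import Data.Product using (∃; ∃₂; _×_; _,_; proj₁; proj₂; map₁)
open import Data.Sum using (_⊎_; inj₁; inj₂)
open import Function using (_∘_; id)
open import Function.Bundles using (_⇔_; mk⇔; module Equivalence)
open import Relation.Binary.Definitions using (tri<; tri≈; tri>)
open import Relation.Binary.PropositionalEquality hiding ([_])
open ≡-Reasoning
open import Data.List.Relation.Binary.Permutation.Setoid (setoid ℕ) using (_↭_; ↭-sym)
import Data.List.Relation.Binary.Permutation.Setoid.Properties (setoid ℕ) as ↭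
open import Relation.Nullary using (Dec; yes; no; does; ¬_)
open import Relation.Nullary.Decidable using (_×-dec_; ¬?; dec-true; dec-false; does-⇔)

module _ {A : Set} where

  sum-map-cong : {f g : A → ℕ} (xs : List A) → (∀ {x} → x ∈ xs → f x ≡ g x) → sum (map f xs) ≡ sum (map g xs)
  sum-map-cong xs f≡g = cong sum (List.map-cong-local (All.tabulate f≡g))

  sum-map-+ : (f g : A → ℕ) (xs : List A) → sum (map (λ x → f x + g x) xs) ≡ sum (map f xs) + sum (map g xs)
  sum-map-+ f g [] = refl
  sum-map-+ f g (x ∷ xs) = begin
    (f x + g x) + sum (map (λ x → f x + g x) xs)      ≡⟨ cong ((f x + g x) +_) (sum-map-+ f g xs) ⟩
    (f x + g x) + (sum (map f xs) + sum (map g xs))   ≡⟨ interchange (f x) (g x) _ _ ⟩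
    (f x + sum (map f xs)) + (g x + sum (map g xs))   ∎

  sum-map-const : (k : ℕ) (xs : List A) → sum (map (λ _ → k) xs) ≡ k * length xs
  sum-map-const k [] = sym (ℕ.*-zeroʳ k)
  sum-map-const k (x ∷ xs) = trans (cong (k +_) (sum-map-const k xs)) (sym (ℕ.*-suc k (length xs)))

  sum-map-zero : {f : A → ℕ} (xs : List A) → (∀ {x} → x ∈ xs → f x ≡ 0) → sum (map f xs) ≡ 0
  sum-map-zero xs f≡0 = trans (sum-map-cong xs f≡0) (trans (sum-map-const 0 xs) (ℕ.*-zeroˡ (length xs)))

  sum-map-filter : {P : A → Set} (P? : ∀ x → Dec (P x)) (f : A → ℕ) (xs : List A) →
                   sum (map f (filter P? xs)) ≡ sum (map (λ x → if does (P? x) then f x else 0) xs)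
  sum-map-filter P? f [] = refl
  sum-map-filter P? f (x ∷ xs) with does (P? x)
  ... | true  = cong (f x +_) (sum-map-filter P? f xs)
  ... | false = sum-map-filter P? f xs

  sum-map-if : ∀ b (G : A → ℕ) xs → sum (map (λ x → if b then G x else 0) xs) ≡ (if b then sum (map G xs) else 0)
  sum-map-if true G xs = refl
  sum-map-if false G xs = sum-map-zero xs (λ _ → refl)

  sum-map-unique : {xs ys : List A} → Unique xs → Unique ys →
                   (∀ {x} → x ∈ xs → x ∈ ys) → (∀ {x} → x ∈ ys → x ∈ xs) →
                   (f : A → ℕ) → sum (map f xs) ≡ sum (map f ys)
  sum-map-unique xs! ys! xs⊆ys ys⊆xs f =
    sum-↭ (↭ₚ.map⁺ f (∼bag⇒↭ (unique∧set⇒bag xs! ys! (mk⇔ xs⊆ys ys⊆xs))))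

module _ {A B : Set} where

  sum-concatMap : (f : B → ℕ) (g : A → List B) (xs : List A) →
                  sum (map f (concatMap g xs)) ≡ sum (map (sum ∘ map f ∘ g) xs)
  sum-concatMap f g [] = refl
  sum-concatMap f g (x ∷ xs) = begin
    sum (map f (g x ++ concatMap g xs))                 ≡⟨ cong sum (List.map-++ f (g x) _) ⟩
    sum (map f (g x) ++ map f (concatMap g xs))         ≡⟨ sum-++ (map f (g x)) _ ⟩
    sum (map f (g x)) + sum (map f (concatMap g xs))    ≡⟨ cong (sum (map f (g x)) +_) (sum-concatMap f g xs) ⟩
    sum (map f (g x)) + sum (map (sum ∘ map f ∘ g) xs)  ∎

  sum-map-swap : (F : A → B → ℕ) (xs : List A) (ys : List B) →
                 sum (map (λ x → sum (map (F x) ys)) xs) ≡ sum (map (λ y → sum (map (λ x → F x y) xs)) ys)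
  sum-map-swap F [] ys = sym (sum-map-zero ys (λ _ → refl))
  sum-map-swap F (x ∷ xs) ys = begin
    sum (map (F x) ys) + sum (map (λ x → sum (map (F x) ys)) xs)        ≡⟨ cong (sum (map (F x) ys) +_) (sum-map-swap F xs ys) ⟩
    sum (map (F x) ys) + sum (map (λ y → sum (map (λ x → F x y) xs)) ys) ≡⟨ sum-map-+ (F x) _ ys ⟨
    sum (map (λ y → sum (map (λ x → F x y) (x ∷ xs))) ys)              ∎

  ∈-concatMap⁺ : (f : A → List B) {xs : List A} {x : A} {y : B} → x ∈ xs → y ∈ f x → y ∈ concatMap f xs
  ∈-concatMap⁺ f x∈ y∈ = ∈.∈-concatMap⁺ f (lose x∈ y∈)

  ∈-concatMap⁻ : (f : A → List B) {xs : List A} {y : B} → y ∈ concatMap f xs → ∃ λ x → x ∈ xs × y ∈ f x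
  ∈-concatMap⁻ f = find ∘ ∈.∈-concatMap⁻ f

  Unique-concatMap⁺ : (f : A → List B) {xs : List A} → Unique xs → (∀ {x} → x ∈ xs → Unique (f x)) →
                      (∀ {x x′ y} → x ∈ xs → x′ ∈ xs → y ∈ f x → y ∈ f x′ → x ≡ x′) → Unique (concatMap f xs)
  Unique-concatMap⁺ f [] _ _ = []
  Unique-concatMap⁺ f {x ∷ xs} (x∉xs ∷ xs!) fx! disjoint =
    Unique.++⁺ (fx! (here refl))
               (Unique-concatMap⁺ f xs! (fx! ∘ there) (λ p q → disjoint (there p) (there q)))
               λ (y∈fx , y∈rest) → let x′ , x′∈ , y∈fx′ = ∈-concatMap⁻ f y∈rest in
                 All.lookup x∉xs x′∈ (disjoint (here refl) (there x′∈) y∈fx y∈fx′)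

sum-upTo-select : ∀ (G : ℕ → ℕ) M → sum (map (λ a → if does (a ≟ M) then G a else 0) (upTo (suc M))) ≡ G M
sum-upTo-select G M = begin
  sum (map select (upTo (suc M)))                 ≡⟨ cong (sum ∘ map select) (List.upTo-∷ʳ M) ⟨
  sum (map select (upTo M ∷ʳ M))                  ≡⟨ cong sum (List.map-++ select (upTo M) [ M ]) ⟩
  sum (map select (upTo M) ++ [ select M ])       ≡⟨ sum-++ (map select (upTo M)) [ select M ] ⟩
  sum (map select (upTo M)) + (select M + 0)      ≡⟨ cong₂ _+_ (sum-map-zero (upTo M) below) (ℕ.+-identityʳ (select M)) ⟩
  select M                                        ≡⟨ cong (λ b → if b then G M else 0) (dec-true (M ≟ M) refl) ⟩
  G M                                             ∎
  where
  select : ℕ → ℕ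
  select a = if does (a ≟ M) then G a else 0
  below : ∀ {a} → a ∈ upTo M → select a ≡ 0
  below a∈ rewrite dec-false (_ ≟ M) (ℕ.<⇒≢ (∈.∈-upTo⁻ a∈)) = refl

if-does-cong : ∀ {A B : Set} (a? : Dec A) (b? : Dec B) → A ⇔ B → ∀ {X Y : ℕ} → (A → X ≡ Y) →
               (if does a? then X else 0) ≡ (if does b? then Y else 0)
if-does-cong (yes a) (yes _) _ X≡Y = X≡Y a
if-does-cong (yes a) (no ¬b) A⇔B _ = ⊥-elim (¬b (Equivalence.to A⇔B a))
if-does-cong (no ¬a) (yes b) A⇔B _ = ⊥-elim (¬a (Equivalence.from A⇔B b))
if-does-cong (no _) (no _) _ _ = refl

-- Permutations as words

PermWord : ℕ → List ℕ → Set
PermWord n u = Unique u × length u ≡ n × All (_< n) u × All (_∈ u) (upTo n)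

permWord? : ∀ n u → Dec (PermWord n u)
permWord? n u = unique? u ×-dec (length u ≟ n) ×-dec All.all? (_<? n) u ×-dec All.all? (_∈? u) (upTo n)

PermWord-resp-↭ : ∀ {n u v} → u ↭ v → PermWord n u → PermWord n v
PermWord-resp-↭ u↭v (u! , len , bounded , covers) =
  ↭.Unique-resp-↭ u↭v u! ,
  trans (sym (↭.xs↭ys⇒|xs|≡|ys| u↭v)) len ,
  ↭.All-resp-↭ (resp (_< _)) u↭v bounded ,
  All.map (↭.∈-resp-↭ u↭v) covers

All<⇒∉ : ∀ {n u} → All (_< n) u → n ∉ u
All<⇒∉ bounded n∈u = ℕ.<-irrefl refl (All.lookup bounded n∈u)

PermWord-∷⁺ : ∀ {n u} → PermWord n u → PermWord (suc n) (n ∷ u)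
PermWord-∷⁺ {n} {u} (u! , len , bounded , covers) =
  All.tabulate (λ z∈u n≡z → All<⇒∉ bounded (subst (_∈ u) (sym n≡z) z∈u)) ∷ u! ,
  cong suc len ,
  ℕ.n<1+n n ∷ All.map ℕ.m≤n⇒m≤1+n bounded ,
  All.tabulate (covered ∘ ℕ.m≤n⇒m<n∨m≡n ∘ ℕ.≤-pred ∘ ∈.∈-upTo⁻)
  where
  covered : ∀ {y} → y < n ⊎ y ≡ n → y ∈ n ∷ u
  covered (inj₁ y<n) = there (All.lookup covers (∈.∈-upTo⁺ y<n))
  covered (inj₂ refl) = here refl

PermWord-∷⁻ : ∀ {n u} → PermWord (suc n) (n ∷ u) → PermWord n u
PermWord-∷⁻ {n} {u} (n∉u ∷ u! , len , _ ∷ bounded , covers) =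
  u! ,
  ℕ.suc-injective len ,
  All.tabulate (λ z∈u → ℕ.≤∧≢⇒< (ℕ.≤-pred (All.lookup bounded z∈u)) (λ z≡n → All.lookup n∉u z∈u (sym z≡n))) ,
  All.tabulate covered
  where
  covered : ∀ {y} → y ∈ upTo n → y ∈ u
  covered y∈ with All.lookup covers (∈.∈-upTo⁺ (ℕ.m≤n⇒m≤1+n (∈.∈-upTo⁻ y∈)))
  ... | here refl = ⊥-elim (ℕ.<-irrefl refl (∈.∈-upTo⁻ y∈))
  ... | there y∈u = y∈u

PermWord-insert : ∀ {n} α β → PermWord n (α ++ β) → PermWord (suc n) (α ++ n ∷ β)
PermWord-insert α β = PermWord-resp-↭ (↭-sym (↭.↭-shift α β)) ∘ PermWord-∷⁺

PermWord-delete : ∀ {n} α β → PermWord (suc n) (α ++ n ∷ β) → PermWord n (α ++ β)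
PermWord-delete α β = PermWord-∷⁻ ∘ PermWord-resp-↭ (↭.↭-shift α β)

insertions : ℕ → List ℕ → List (List ℕ)
insertions M [] = [ M ] ∷ []
insertions M (x ∷ xs) = (M ∷ x ∷ xs) ∷ map (x ∷_) (insertions M xs)

∈-insertions⁺ : ∀ M α β → α ++ M ∷ β ∈ insertions M (α ++ β)
∈-insertions⁺ M [] [] = here refl
∈-insertions⁺ M [] (b ∷ β) = here refl
∈-insertions⁺ M (a ∷ α) β = there (∈.∈-map⁺ (a ∷_) (∈-insertions⁺ M α β))

∈-insertions⁻ : ∀ {M} u {v} → v ∈ insertions M u → ∃₂ λ α β → u ≡ α ++ β × v ≡ α ++ M ∷ β
∈-insertions⁻ [] (here refl) = [] , [] , refl , refl
∈-insertions⁻ (x ∷ xs) (here refl) = [] , x ∷ xs , refl , refl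
∈-insertions⁻ (x ∷ xs) (there v∈) with ∈.∈-map⁻ (x ∷_) v∈
... | w , w∈ , refl with ∈-insertions⁻ xs w∈
...   | α , β , refl , refl = x ∷ α , β , refl , refl

length-insertions : ∀ M u → length (insertions M u) ≡ suc (length u)
length-insertions M [] = refl
length-insertions M (x ∷ xs) = cong suc (trans (List.length-map (x ∷_) (insertions M xs)) (length-insertions M xs))

insertions-unique : ∀ {M} u → M ∉ u → Unique (insertions M u)
insertions-unique [] _ = [] ∷ []
insertions-unique {M} (x ∷ xs) M∉ =
  All.tabulate head-differs ∷ Unique.map⁺ List.∷-injectiveʳ (insertions-unique xs (M∉ ∘ there))
  where
  head-differs : ∀ {w} → w ∈ map (x ∷_) (insertions M xs) → M ∷ x ∷ xs ≢ w
  head-differs w∈ eq with ∈.∈-map⁻ (x ∷_) w∈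
  ... | _ , _ , refl = M∉ (here (List.∷-injectiveˡ eq))

++-∷-injective : ∀ {M : ℕ} α α′ {β β′} → M ∉ α → M ∉ α′ →
                 α ++ M ∷ β ≡ α′ ++ M ∷ β′ → α ≡ α′ × β ≡ β′
++-∷-injective [] [] _ _ eq = refl , List.∷-injectiveʳ eq
++-∷-injective [] (a′ ∷ α′) _ M∉α′ eq = ⊥-elim (M∉α′ (here (List.∷-injectiveˡ eq)))
++-∷-injective (a ∷ α) [] M∉α _ eq = ⊥-elim (M∉α (here (sym (List.∷-injectiveˡ eq))))
++-∷-injective (a ∷ α) (a′ ∷ α′) M∉α M∉α′ eq with List.∷-injective eq
... | refl , eq′ = map₁ (cong (a ∷_)) (++-∷-injective α α′ (M∉α ∘ there) (M∉α′ ∘ there) eq′)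

permWords : ℕ → List (List ℕ)
permWords zero = [] ∷ []
permWords (suc n) = concatMap (insertions n) (permWords n)

∈-permWords⁻ : ∀ n {u} → u ∈ permWords n → PermWord n u
∈-permWords⁻ zero (here refl) = [] , refl , [] , []
∈-permWords⁻ (suc n) v∈ with ∈-concatMap⁻ (insertions n) v∈
... | u , u∈ , v∈′ with ∈-insertions⁻ u v∈′
...   | α , β , refl , refl = PermWord-insert α β (∈-permWords⁻ n u∈)

∈-permWords⁺ : ∀ n {v} → PermWord n v → v ∈ permWords n
∈-permWords⁺ zero {[]} _ = here refl
∈-permWords⁺ (suc n) pv@(_ , _ , _ , covers) with ∈.∈-∃++ (All.lookup covers (∈.∈-upTo⁺ (ℕ.n<1+n n)))
... | α , β , refl = ∈-concatMap⁺ (insertions n) (∈-permWords⁺ n (PermWord-delete α β pv)) (∈-insertions⁺ n α β)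

permWords-unique : ∀ n → Unique (permWords n)
permWords-unique zero = [] ∷ []
permWords-unique (suc n) =
  Unique-concatMap⁺ (insertions n) (permWords-unique n)
    (λ {u} u∈ → insertions-unique u (All<⇒∉ (bounded u∈)))
    same-origin
  where
  bounded : ∀ {u} → u ∈ permWords n → All (_< n) u
  bounded u∈ = proj₁ (proj₂ (proj₂ (∈-permWords⁻ n u∈)))
  same-origin : ∀ {u u′ v} → u ∈ permWords n → u′ ∈ permWords n →
                v ∈ insertions n u → v ∈ insertions n u′ → u ≡ u′
  same-origin {u} {u′} u∈ u′∈ v∈ v∈′ with ∈-insertions⁻ u v∈ | ∈-insertions⁻ u′ v∈′
  ... | α , β , refl , refl | α′ , β′ , refl , v≡ =
    let α≡ , β≡ = ++-∷-injective α α′ (All<⇒∉ (bounded u∈) ∘ ∈.∈-++⁺ˡ)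
                                     (All<⇒∉ (bounded u′∈) ∘ ∈.∈-++⁺ˡ) v≡
    in cong₂ _++_ α≡ β≡

length-permWords : ∀ n → length (permWords n) ≡ n !
length-permWords zero = refl
length-permWords (suc n) = begin
  length (concatMap (insertions n) (permWords n))                   ≡⟨ length≡sum-of-ones (concatMap (insertions n) (permWords n)) ⟩
  sum (map (λ _ → 1) (concatMap (insertions n) (permWords n)))      ≡⟨ sum-concatMap (λ _ → 1) (insertions n) (permWords n) ⟩
  sum (map (λ u → sum (map (λ _ → 1) (insertions n u))) (permWords n)) ≡⟨ sum-map-cong (permWords n) ones-per-word ⟩
  sum (map (λ _ → suc n) (permWords n))                             ≡⟨ sum-map-const (suc n) (permWords n) ⟩
  suc n * length (permWords n)                                      ≡⟨ cong (suc n *_) (length-permWords n) ⟩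
  suc n * n !                                                       ∎
  where
  length≡sum-of-ones : ∀ {A : Set} (xs : List A) → length xs ≡ sum (map (λ _ → 1) xs)
  length≡sum-of-ones xs = sym (trans (sum-map-const 1 xs) (ℕ.*-identityˡ (length xs)))
  ones-per-word : ∀ {u} → u ∈ permWords n → sum (map (λ _ → 1) (insertions n u)) ≡ suc n
  ones-per-word {u} u∈ = begin
    sum (map (λ _ → 1) (insertions n u))  ≡⟨ length≡sum-of-ones (insertions n u) ⟨
    length (insertions n u)               ≡⟨ length-insertions n u ⟩
    suc (length u)                        ≡⟨ cong suc (proj₁ (proj₂ (∈-permWords⁻ n u∈))) ⟩
    suc n                                 ∎

words : ℕ → ℕ → List (List ℕ)
words zero m = [] ∷ []
words (suc k) m = concatMap (λ a → map (a ∷_) (words k m)) (upTo m)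

∈-words⁻ : ∀ k m {u} → u ∈ words k m → length u ≡ k × All (_< m) u
∈-words⁻ zero m (here refl) = refl , []
∈-words⁻ (suc k) m u∈ with ∈-concatMap⁻ (λ a → map (a ∷_) (words k m)) {upTo m} u∈
... | a , a∈ , u∈′ with ∈.∈-map⁻ (a ∷_) u∈′
...   | w , w∈ , refl with ∈-words⁻ k m w∈
...     | len , bounded = cong suc len , ∈.∈-upTo⁻ a∈ ∷ bounded

∈-words⁺ : ∀ k m {u} → length u ≡ k → All (_< m) u → u ∈ words k m
∈-words⁺ zero m {[]} refl [] = here refl
∈-words⁺ (suc k) m {a ∷ u} len (a<m ∷ bounded) =
  ∈-concatMap⁺ (λ b → map (b ∷_) (words k m)) (∈.∈-upTo⁺ a<m)
    (∈.∈-map⁺ (a ∷_) (∈-words⁺ k m (ℕ.suc-injective len) bounded))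

words-unique : ∀ k m → Unique (words k m)
words-unique zero m = [] ∷ []
words-unique (suc k) m =
  Unique-concatMap⁺ (λ a → map (a ∷_) (words k m)) (Unique.upTo⁺ m)
    (λ _ → Unique.map⁺ List.∷-injectiveʳ (words-unique k m))
    (λ {a} {a′} _ _ u∈ u∈′ → same-head (∈.∈-map⁻ (a ∷_) u∈) (∈.∈-map⁻ (a′ ∷_) u∈′))
  where
  same-head : ∀ {a a′ u} → ∃ (λ w → w ∈ words k m × u ≡ a ∷ w) →
              ∃ (λ w → w ∈ words k m × u ≡ a′ ∷ w) → a ≡ a′
  same-head (_ , _ , refl) (_ , _ , eq) = List.∷-injectiveˡ eq

tabulate-toℕ : ∀ {A : Set} n (g : ℕ → A) → tabulate {n = n} (g ∘ toℕ) ≡ applyUpTo g n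
tabulate-toℕ zero g = refl
tabulate-toℕ (suc n) g = cong (g 0 ∷_) (tabulate-toℕ n (g ∘ suc))

wordOf : ∀ {k m} → (Fin k → Fin m) → List ℕ
wordOf π = tabulate (toℕ ∘ π)

map-wordOf-allFuns : ∀ k m → map wordOf (allFuns k m) ≡ words k m
map-wordOf-allFuns zero m = refl
map-wordOf-allFuns (suc k) m =
  trans (List.map-concatMap wordOf _ (allFin m)) (trans (List.concatMap-cong (λ a → prepend-head a (λ _ → refl)) (allFin m)) (begin
  concatMap ((λ b → map (b ∷_) (words k m)) ∘ toℕ) (allFin m)
    ≡⟨ List.concatMap-map (λ b → map (b ∷_) (words k m)) toℕ (allFin m) ⟨
  concatMap (λ b → map (b ∷_) (words k m)) (map toℕ (allFin m))
    ≡⟨ cong (concatMap (λ b → map (b ∷_) (words k m))) (trans (List.map-tabulate id toℕ) (tabulate-toℕ m id)) ⟩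
  concatMap (λ b → map (b ∷_) (words k m)) (upTo m)
    ∎))
  where
  prepend-head : ∀ a {G : (Fin k → Fin m) → Fin (suc k) → Fin m} → (∀ f → wordOf (G f) ≡ toℕ a ∷ wordOf f) →
                 map wordOf (map G (allFuns k m)) ≡ map (toℕ a ∷_) (words k m)
  prepend-head a {G} wordOf-G = begin
    map wordOf (map G (allFuns k m))            ≡⟨ List.map-∘ (allFuns k m) ⟨
    map (wordOf ∘ G) (allFuns k m)              ≡⟨ List.map-cong wordOf-G (allFuns k m) ⟩
    map ((toℕ a ∷_) ∘ wordOf) (allFuns k m)     ≡⟨ List.map-∘ (allFuns k m) ⟩
    map (toℕ a ∷_) (map wordOf (allFuns k m))   ≡⟨ cong (map (toℕ a ∷_)) (map-wordOf-allFuns k m) ⟩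
    map (toℕ a ∷_) (words k m)                  ∎

Unique-tabulate⁻ : ∀ {n} (g : Fin n → ℕ) → Unique (tabulate g) → ∀ i j → g i ≡ g j → i ≡ j
Unique-tabulate⁻ g (g0∉ ∷ _) Fin.zero Fin.zero _ = refl
Unique-tabulate⁻ g (g0∉ ∷ _) Fin.zero (Fin.suc j) eq = ⊥-elim (All.lookup g0∉ (∈.∈-tabulate⁺ j) eq)
Unique-tabulate⁻ g (g0∉ ∷ _) (Fin.suc i) Fin.zero eq = ⊥-elim (All.lookup g0∉ (∈.∈-tabulate⁺ i) (sym eq))
Unique-tabulate⁻ g (_ ∷ rest!) (Fin.suc i) (Fin.suc j) eq = cong Fin.suc (Unique-tabulate⁻ (g ∘ Fin.suc) rest! i j eq)

IsPerm⇒PermWord : ∀ {n} (π : Fin n → Fin n) → IsPerm π → PermWord n (wordOf π)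
IsPerm⇒PermWord {n} π (injective , surjective) =
  Unique.tabulate⁺ (λ {i} {j} eq → injective i j (Fin.toℕ-injective eq)) ,
  List.length-tabulate (toℕ ∘ π) ,
  Allₚ.tabulate⁺ (λ i → Fin.toℕ<n (π i)) ,
  All.tabulate covered
  where
  covered : ∀ {y} → y ∈ upTo n → y ∈ wordOf π
  covered y∈ with surjective (fromℕ< (∈.∈-upTo⁻ y∈))
  ... | x , πx≡ = subst (_∈ wordOf π) (trans (cong toℕ πx≡) (Fin.toℕ-fromℕ< (∈.∈-upTo⁻ y∈))) (∈.∈-tabulate⁺ x)

PermWord⇒IsPerm : ∀ {n} (π : Fin n → Fin n) → PermWord n (wordOf π) → IsPerm π
PermWord⇒IsPerm π (unique , _ , _ , covers) =
  (λ i j eq → Unique-tabulate⁻ (toℕ ∘ π) unique i j (cong toℕ eq)) ,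
  λ y → let x , y≡ = ∈.∈-tabulate⁻ (All.lookup covers (∈.∈-upTo⁺ (Fin.toℕ<n y))) in x , Fin.toℕ-injective (sym y≡)

Triple : Set
Triple = ℕ × ℕ × ℕ

windows : List ℕ → List Triple
windows (a ∷ b ∷ c ∷ r) = (a , b , c) ∷ windows (b ∷ c ∷ r)
windows _ = []

DoubleAscent DoubleDescent : Triple → Set
DoubleAscent (a , b , c) = a < b × b < c
DoubleDescent (a , b , c) = b < a × c < b

doubleAscent? : ∀ t → Dec (DoubleAscent t)
doubleAscent? (a , b , c) = (a <? b) ×-dec (b <? c)

doubleDescent? : ∀ t → Dec (DoubleDescent t)
doubleDescent? (a , b , c) = (b <? a) ×-dec (c <? b)

noDoubleAscent : List Triple → Bool
noDoubleAscent [] = true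
noDoubleAscent (t ∷ ts) = not (does (doubleAscent? t)) ∧ noDoubleAscent ts

doubleDescent𝟙 : Triple → ℕ
doubleDescent𝟙 t = if does (doubleDescent? t) then 1 else 0

doubleDescents : List Triple → ℕ
doubleDescents ts = sum (map doubleDescent𝟙 ts)

weight : List Triple → ℕ
weight ts = if noDoubleAscent ts then 2 ^ doubleDescents ts else 0

-- Indices are read modulo the length: the last two windows wrap around.
cyclicWeight : List ℕ → ℕ
cyclicWeight u = weight (windows (u ++ take 2 u))

noDoubleAscent-++ : ∀ ts us → noDoubleAscent (ts ++ us) ≡ noDoubleAscent ts ∧ noDoubleAscent us
noDoubleAscent-++ [] us = refl
noDoubleAscent-++ (t ∷ ts) us =
  trans (cong (not (does (doubleAscent? t)) ∧_) (noDoubleAscent-++ ts us))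
        (sym (Bool.∧-assoc (not (does (doubleAscent? t))) (noDoubleAscent ts) (noDoubleAscent us)))

noDoubleAscent-all? : ∀ ts → noDoubleAscent ts ≡ does (All.all? (¬? ∘ doubleAscent?) ts)
noDoubleAscent-all? [] = refl
noDoubleAscent-all? (t ∷ ts) = cong (not (does (doubleAscent? t)) ∧_) (noDoubleAscent-all? ts)

doubleDescents-++ : ∀ ts us → doubleDescents (ts ++ us) ≡ doubleDescents ts + doubleDescents us
doubleDescents-++ ts us =
  trans (cong sum (List.map-++ doubleDescent𝟙 ts us)) (sum-++ (map doubleDescent𝟙 ts) (map doubleDescent𝟙 us))

weight-rotate : ∀ ts t → weight (ts ++ [ t ]) ≡ weight (t ∷ ts)
weight-rotate ts t
  rewrite noDoubleAscent-++ ts [ t ] | doubleDescents-++ ts [ t ]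
        | Bool.∧-identityʳ (not (does (doubleAscent? t))) | Bool.∧-comm (noDoubleAscent ts) (not (does (doubleAscent? t)))
        | ℕ.+-identityʳ (doubleDescent𝟙 t)
        | ℕ.+-comm (doubleDescents ts) (doubleDescent𝟙 t) = refl

weight-snoc-neutral : ∀ ts t → does (doubleAscent? t) ≡ false → does (doubleDescent? t) ≡ false →
                       weight (ts ++ [ t ]) ≡ weight ts
weight-snoc-neutral ts t ¬asc ¬desc
  rewrite noDoubleAscent-++ ts [ t ] | doubleDescents-++ ts [ t ] | ¬asc | ¬desc
        | Bool.∧-identityʳ (noDoubleAscent ts) | ℕ.+-identityʳ (doubleDescents ts) = refl

windows-snoc : ∀ s x y z → windows (s ++ x ∷ y ∷ [ z ]) ≡ windows (s ++ x ∷ [ y ]) ++ [ (x , y , z) ]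
windows-snoc [] x y z = refl
windows-snoc (a ∷ []) x y z = refl
windows-snoc (a ∷ b ∷ []) x y z = refl
windows-snoc (a ∷ b ∷ c ∷ s) x y z = cong ((a , b , c) ∷_) (windows-snoc (b ∷ c ∷ s) x y z)

rotate : List ℕ → List ℕ
rotate [] = []
rotate (a ∷ r) = r ∷ʳ a

cyclicWeight-rotate : ∀ u → cyclicWeight (rotate u) ≡ cyclicWeight u
cyclicWeight-rotate [] = refl
cyclicWeight-rotate (a ∷ []) = refl
cyclicWeight-rotate (a ∷ b ∷ []) = weight-rotate [ (b , a , b) ] (a , b , a)
cyclicWeight-rotate (a ∷ b ∷ c ∷ r) = begin
  weight (windows ((b ∷ c ∷ r ++ [ a ]) ++ b ∷ [ c ]))    ≡⟨ cong (weight ∘ windows) (List.++-assoc (b ∷ c ∷ r) [ a ] (b ∷ [ c ])) ⟩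
  weight (windows (b ∷ c ∷ r ++ a ∷ b ∷ [ c ]))           ≡⟨ cong weight (windows-snoc (b ∷ c ∷ r) a b c) ⟩
  weight (windows (b ∷ c ∷ r ++ a ∷ [ b ]) ++ [ (a , b , c) ]) ≡⟨ weight-rotate (windows (b ∷ c ∷ r ++ a ∷ [ b ])) (a , b , c) ⟩
  weight (windows (a ∷ b ∷ c ∷ r ++ a ∷ [ b ]))           ∎

∷-∷ʳ-view : ∀ (x : ℕ) xs → ∃₂ λ u z → x ∷ xs ≡ u ∷ʳ z
∷-∷ʳ-view x [] = [] , x , refl
∷-∷ʳ-view x (y ∷ ys) with ∷-∷ʳ-view y ys
... | u , z , eq = x ∷ u , z , cong (x ∷_) eq

framedWeight : ℕ → List ℕ → ℕ
framedWeight M u = weight (windows (M ∷ u ++ [ M ]))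

-- With the maximum M in front, the wrap-around window (last u, M, first u) is a peak, so it can be dropped.
cyclicWeight-max-first : ∀ M x xs → All (_< M) (x ∷ xs) →
                         cyclicWeight (M ∷ x ∷ xs) ≡ framedWeight M (x ∷ xs)
cyclicWeight-max-first M x xs bounded@(x<M ∷ _) with ∷-∷ʳ-view x xs
... | u , z , eq = begin
  weight (windows (M ∷ (x ∷ xs) ++ M ∷ [ x ]))         ≡⟨ cong (λ w → weight (windows (M ∷ w ++ M ∷ [ x ]))) eq ⟩
  weight (windows ((M ∷ u ∷ʳ z) ++ M ∷ [ x ]))          ≡⟨ cong (weight ∘ windows) (List.++-assoc (M ∷ u) [ z ] (M ∷ [ x ])) ⟩
  weight (windows ((M ∷ u) ++ z ∷ M ∷ [ x ]))           ≡⟨ cong weight (windows-snoc (M ∷ u) z M x) ⟩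
  weight (windows ((M ∷ u) ++ z ∷ [ M ]) ++ [ (z , M , x) ])
    ≡⟨ weight-snoc-neutral (windows ((M ∷ u) ++ z ∷ [ M ])) (z , M , x) peak-not-ascent peak-not-descent ⟩
  weight (windows ((M ∷ u) ++ z ∷ [ M ]))               ≡⟨ cong (weight ∘ windows) (List.++-assoc (M ∷ u) [ z ] [ M ]) ⟨
  weight (windows ((M ∷ u ∷ʳ z) ++ [ M ]))              ≡⟨ cong (λ w → weight (windows (M ∷ w ++ [ M ]))) eq ⟨
  weight (windows (M ∷ (x ∷ xs) ++ [ M ]))              ∎
  where
  z<M : z < M
  z<M = proj₂ (Allₚ.∷ʳ⁻ (subst (All (_< M)) eq bounded))
  peak-not-ascent : does (doubleAscent? (z , M , x)) ≡ false
  peak-not-ascent rewrite dec-false (M <? x) (ℕ.<-asym x<M) = Bool.∧-zeroʳ (does (z <? M))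
  peak-not-descent : does (doubleDescent? (z , M , x)) ≡ false
  peak-not-descent rewrite dec-false (M <? z) (ℕ.<-asym z<M) = refl

module _ {n : ℕ} .{{_ : NonZero n}} where

  mod-toℕ : (i : Fin n) → toℕ i mod n ≡ i
  mod-toℕ i = Fin.toℕ-injective (trans (Fin.toℕ-fromℕ< _) (m<n⇒m%n≡m (Fin.toℕ<n i)))

  csuc-mod : ∀ j → csuc (j mod n) ≡ suc j mod n
  csuc-mod j = Fin.toℕ-injective (begin
    toℕ (suc (toℕ (j mod n)) mod n)  ≡⟨ Fin.toℕ-fromℕ< _ ⟩
    suc (toℕ (j mod n)) % n          ≡⟨ cong (λ k → suc k % n) (Fin.toℕ-fromℕ< _) ⟩
    (1 + j % n) % n                  ≡⟨ %-distribˡ-+ 1 (j % n) n ⟩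
    (1 % n + j % n % n) % n          ≡⟨ cong (λ k → (1 % n + k) % n) (m%n%n≡m%n j n) ⟩
    (1 % n + j % n) % n              ≡⟨ %-distribˡ-+ 1 j n ⟨
    suc j % n                        ≡⟨ Fin.toℕ-fromℕ< _ ⟨
    toℕ (suc j mod n)                ∎)

triple : (ℕ → ℕ) → ℕ → Triple
triple g j = g j , g (suc j) , g (suc (suc j))

windows-applyUpTo : ∀ g k → windows (applyUpTo g (suc (suc k))) ≡ applyUpTo (triple g) k
windows-applyUpTo g zero = refl
windows-applyUpTo g (suc k) = cong (triple g 0 ∷_) (windows-applyUpTo (g ∘ suc) k)

-- Read periodically, π turns its cyclic windows into the windows of its word extended by the first two letters.
module _ {p : ℕ} (π : Fin (suc (suc p)) → Fin (suc (suc p))) where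

  private
    n = suc (suc p)

  window : Fin n → Triple
  window i = toℕ (π i) , toℕ (π (csuc i)) , toℕ (π (csuc (csuc i)))

  periodic : ℕ → ℕ
  periodic j = toℕ (π (j mod n))

  window≡triple : ∀ i → window i ≡ triple periodic (toℕ i)
  window≡triple i = trans (cong window (sym (mod-toℕ i))) (window-mod (toℕ i))
    where
    window-mod : ∀ j → window (j mod n) ≡ triple periodic j
    window-mod j = cong₂ (λ b c → periodic j , b , c)
                         (cong (toℕ ∘ π) (csuc-mod j))
                         (cong (toℕ ∘ π) (trans (cong csuc (csuc-mod j)) (csuc-mod (suc j))))

  word-extended : wordOf π ++ take 2 (wordOf π) ≡ applyUpTo periodic (suc (suc n))
  word-extended = begin
    wordOf π ++ toℕ (π Fin.zero) ∷ [ toℕ (π (Fin.suc Fin.zero)) ]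
      ≡⟨ cong₂ _++_ word-periodic (cong₂ (λ a b → a ∷ [ b ]) (cong (toℕ ∘ π) (sym n-mod-n))
                                                             (cong (toℕ ∘ π) (sym suc-n-mod-n))) ⟩
    applyUpTo periodic n ++ periodic n ∷ [ periodic (suc n) ]
      ≡⟨ List.++-assoc (applyUpTo periodic n) [ periodic n ] [ periodic (suc n) ] ⟨
    (applyUpTo periodic n ∷ʳ periodic n) ∷ʳ periodic (suc n)
      ≡⟨ cong (_∷ʳ periodic (suc n)) (List.applyUpTo-∷ʳ periodic n) ⟩
    applyUpTo periodic (suc n) ∷ʳ periodic (suc n)
      ≡⟨ List.applyUpTo-∷ʳ periodic (suc n) ⟩
    applyUpTo periodic (suc (suc n))
      ∎
    where
    word-periodic : wordOf π ≡ applyUpTo periodic n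
    word-periodic = trans (List.tabulate-cong (λ i → cong (toℕ ∘ π) (sym (mod-toℕ i)))) (tabulate-toℕ n periodic)
    n-mod-n : n mod n ≡ Fin.zero
    n-mod-n = Fin.toℕ-injective (trans (Fin.toℕ-fromℕ< _) (n%n≡0 n))
    suc-n-mod-n : suc n mod n ≡ Fin.suc Fin.zero
    suc-n-mod-n =
      Fin.toℕ-injective (trans (Fin.toℕ-fromℕ< _) (trans ([m+n]%n≡m%n 1 n) (m<n⇒m%n≡m {n = n} (s≤s (s≤s z≤n)))))

  windows-cyclic : map window (allFin n) ≡ windows (wordOf π ++ take 2 (wordOf π))
  windows-cyclic = begin
    map window (allFin n)                         ≡⟨ List.map-tabulate id window ⟩
    tabulate window                               ≡⟨ List.tabulate-cong window≡triple ⟩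
    tabulate (triple periodic ∘ toℕ)              ≡⟨ tabulate-toℕ n (triple periodic) ⟩
    applyUpTo (triple periodic) n                 ≡⟨ windows-applyUpTo periodic n ⟨
    windows (applyUpTo periodic (suc (suc n)))    ≡⟨ cong windows word-extended ⟨
    windows (wordOf π ++ take 2 (wordOf π))       ∎

  cyclicWeight-wordOf : (if does (cyc123Avoiding? π) then 2 ^ bbc π else 0) ≡ cyclicWeight (wordOf π)
  cyclicWeight-wordOf =
    trans (cong₂ (λ b k → if b then 2 ^ k else 0) avoiding≡
                 (cong sum (List.map-∘ {g = doubleDescent𝟙} {f = window} (allFin n))))
          (cong weight windows-cyclic)
    where
    avoiding⇔ : Cyclically123Avoiding π ⇔ All (¬_ ∘ DoubleAscent) (map window (allFin n))
    avoiding⇔ = mk⇔ (λ avoids → Allₚ.map⁺ (Allₚ.tabulate⁺ avoids))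
                    (λ none i → All.lookup (Allₚ.map⁻ none) (∈.∈-allFin i))
    avoiding≡ : does (cyc123Avoiding? π) ≡ noDoubleAscent (map window (allFin n))
    avoiding≡ = trans (does-⇔ avoiding⇔ (cyc123Avoiding? π) (All.all? (¬? ∘ doubleAscent?) (map window (allFin n))))
                      (sym (noDoubleAscent-all? (map window (allFin n))))

-- Peaks, double ascents, double descents, and insertion of a maximum

record Stat : Set where
  constructor ⟨_,_,_⟩
  field
    peaks dasc ddes : ℕ
open Stat

infixr 6 _⊕_
_⊕_ : Stat → Stat → Stat
⟨ p , x , y ⟩ ⊕ ⟨ p′ , x′ , y′ ⟩ = ⟨ p + p′ , x + x′ , y + y′ ⟩

𝟘 : Stat
𝟘 = ⟨ 0 , 0 , 0 ⟩

Stat-≡ : ∀ {p x y p′ x′ y′} → p ≡ p′ → x ≡ x′ → y ≡ y′ → ⟨ p , x , y ⟩ ≡ ⟨ p′ , x′ , y′ ⟩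
Stat-≡ refl refl refl = refl

⊕-comm-middle : ∀ a e s → a ⊕ (e ⊕ s) ≡ e ⊕ (a ⊕ s)
⊕-comm-middle a e s =
  Stat-≡ (x∙yz≈y∙xz (peaks a) (peaks e) (peaks s))
         (x∙yz≈y∙xz (dasc a) (dasc e) (dasc s))
         (x∙yz≈y∙xz (ddes a) (ddes e) (ddes s))

-- A gap is true for an ascent; two consecutive gaps form a peak, a double ascent, a double descent or a valley.
pairStat : Bool → Bool → Stat
pairStat true  false = ⟨ 1 , 0 , 0 ⟩
pairStat true  true  = ⟨ 0 , 1 , 0 ⟩
pairStat false false = ⟨ 0 , 0 , 1 ⟩
pairStat false true  = 𝟘

gapStat : Bool → List Bool → Stat
gapStat a [] = 𝟘
gapStat a (b ∷ bs) = pairStat a b ⊕ gapStat b bs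

gaps : List ℕ → List Bool
gaps (a ∷ b ∷ r) = does (a <? b) ∷ gaps (b ∷ r)
gaps _ = []

-- The frame +∞ u +∞ adds a descent in front and an ascent at the end.
framedStat : Bool → List Bool → Stat
framedStat c g = gapStat c (g ++ [ true ])

stat : List ℕ → Stat
stat u = framedStat false (gaps u)

-- Putting a new maximum right after the i-th letter replaces the i-th gap by an ascent and a descent.
insertionGaps : List Bool → List (List Bool)
insertionGaps [] = [ true ] ∷ []
insertionGaps (b ∷ g) = (true ∷ false ∷ g) ∷ map (b ∷_) (insertionGaps g)

gaps-insertions : ∀ M x xs → All (_< M) (x ∷ xs) →
                  map gaps (insertions M (x ∷ xs)) ≡ (false ∷ gaps (x ∷ xs)) ∷ insertionGaps (gaps (x ∷ xs))
gaps-insertions M x [] (x<M ∷ []) rewrite dec-true (x <? M) x<M | dec-false (M <? x) (ℕ.<-asym x<M) = refl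
gaps-insertions M x (y ∷ r) (x<M ∷ bounded@(y<M ∷ _))
  rewrite dec-true (x <? M) x<M | dec-false (M <? x) (ℕ.<-asym x<M) | dec-false (M <? y) (ℕ.<-asym y<M) =
  cong (λ gs → (false ∷ does (x <? y) ∷ gaps (y ∷ r)) ∷ (true ∷ false ∷ gaps (y ∷ r)) ∷ gs) (begin
    map gaps (map (x ∷_) (map (y ∷_) I))            ≡⟨ cong (map gaps) (List.map-∘ I) ⟨
    map gaps (map (λ w → x ∷ y ∷ w) I)              ≡⟨ List.map-∘ I ⟨
    map (λ w → does (x <? y) ∷ gaps (y ∷ w)) I      ≡⟨ List.map-∘ I ⟩
    map (does (x <? y) ∷_) (map (gaps ∘ (y ∷_)) I)  ≡⟨ cong (map (does (x <? y) ∷_)) (List.map-∘ I) ⟩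
    map (does (x <? y) ∷_) (map gaps (map (y ∷_) I)) ≡⟨ cong (map (does (x <? y) ∷_)) (List.∷-injectiveʳ (gaps-insertions M y r bounded)) ⟩
    map (does (x <? y) ∷_) (insertionGaps (gaps (y ∷ r)))  ∎)
  where
  I = insertions M r

data Move : Set where
  ddes⁺ dasc⁺ dasc⇒peak ddes⇒peak : Move

gain loss : Move → Stat
gain ddes⁺     = ⟨ 0 , 0 , 1 ⟩
gain dasc⁺     = ⟨ 0 , 1 , 0 ⟩
gain dasc⇒peak = ⟨ 1 , 0 , 0 ⟩
gain ddes⇒peak = ⟨ 1 , 0 , 0 ⟩
loss ddes⁺     = 𝟘
loss dasc⁺     = 𝟘
loss dasc⇒peak = ⟨ 0 , 1 , 0 ⟩
loss ddes⇒peak = ⟨ 0 , 0 , 1 ⟩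

move : Move → Stat → Stat
move ddes⁺     ⟨ p , x , y ⟩ = ⟨ p , x , suc y ⟩
move dasc⁺     ⟨ p , x , y ⟩ = ⟨ p , suc x , y ⟩
move dasc⇒peak ⟨ p , x , y ⟩ = ⟨ suc p , x ∸ 1 , y ⟩
move ddes⇒peak ⟨ p , x , y ⟩ = ⟨ suc p , x , y ∸ 1 ⟩

-- Moves are recorded additively because x ∸ 1 does not commute with adding to x.
Moved : Stat → Stat → Move → Set
Moved s a d = loss d ⊕ a ≡ gain d ⊕ s

Moved⇒≡move : ∀ {s a} d → Moved s a d → a ≡ move d s
Moved⇒≡move ddes⁺     eq = eq
Moved⇒≡move dasc⁺     eq = eq
Moved⇒≡move dasc⇒peak eq = cong (λ t → ⟨ peaks t , pred (dasc t) , ddes t ⟩) eq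
Moved⇒≡move ddes⇒peak eq = cong (λ t → ⟨ peaks t , dasc t , pred (ddes t) ⟩) eq

next : List Bool → Bool
next [] = true
next (b ∷ _) = b

-- The move caused by replacing the gap b, which follows the gap c and precedes the gap h.
moveAt : Bool → Bool → Bool → Move
moveAt c     true  true  = dasc⇒peak
moveAt c     true  false = ddes⁺
moveAt true  false h     = dasc⁺
moveAt false false h     = ddes⇒peak

movesOf : Bool → List Bool → List Move
movesOf c [] = dasc⁺ ∷ []
movesOf c (b ∷ g) = moveAt c b (next g) ∷ movesOf b g

insertionGaps-Moved : ∀ c g → Pointwise (λ h → Moved (framedStat c g) (framedStat c h)) (insertionGaps g) (movesOf c g)
insertionGaps-Moved c [] = first c ∷ []
  where
  first : ∀ c → Moved (framedStat c []) (framedStat c [ true ]) dasc⁺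
  first true = refl
  first false = refl
insertionGaps-Moved c (b ∷ g) = first c b g ∷ shift (insertionGaps-Moved b g)
  where
  first : ∀ c b g → Moved (framedStat c (b ∷ g)) (framedStat c (true ∷ false ∷ g)) (moveAt c b (next g))
  first true  true  []      = refl
  first true  false []      = refl
  first false true  []      = refl
  first false false []      = refl
  first true  true  (true  ∷ _) = refl
  first true  true  (false ∷ _) = refl
  first true  false (true  ∷ _) = refl
  first true  false (false ∷ _) = refl
  first false true  (true  ∷ _) = refl
  first false true  (false ∷ _) = refl
  first false false (true  ∷ _) = refl
  first false false (false ∷ _) = refl
  shift : ∀ {hs ds} → Pointwise (λ h → Moved (framedStat b g) (framedStat b h)) hs ds →
          Pointwise (λ h → Moved (framedStat c (b ∷ g)) (framedStat c h)) (map (b ∷_) hs) ds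
  shift [] = []
  shift {h ∷ _} {d ∷ _} (moved ∷ rest) =
    trans (⊕-comm-middle (loss d) (pairStat c b) (framedStat b h))
          (trans (cong (pairStat c b ⊕_) moved) (sym (⊕-comm-middle (gain d) (pairStat c b) (framedStat b g))))
    ∷ shift rest

sum-Moved : ∀ {A : Set} (G : Stat → ℕ) (F : A → Stat) {s hs ds} → Pointwise (λ h → Moved s (F h)) hs ds →
            sum (map (G ∘ F) hs) ≡ sum (map (λ d → G (move d s)) ds)
sum-Moved G F [] = refl
sum-Moved G F {ds = d ∷ _} (moved ∷ rest) = cong₂ _+_ (cong G (Moved⇒≡move d moved)) (sum-Moved G F rest)

-- Each peak allows the moves ddes⁺ and dasc⁺, each double ascent dasc⇒peak, each double descent ddes⇒peak.
weigh : (Move → ℕ) → Stat → ℕ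
weigh F ⟨ p , x , y ⟩ = p * (F ddes⁺ + F dasc⁺) + x * F dasc⇒peak + y * F ddes⇒peak

weigh-⊕ : ∀ F a b → weigh F (a ⊕ b) ≡ weigh F a + weigh F b
weigh-⊕ F ⟨ p , x , y ⟩ ⟨ p′ , x′ , y′ ⟩ = distrib p x y p′ x′ y′ (F ddes⁺ + F dasc⁺) (F dasc⇒peak) (F ddes⇒peak)
  where
  distrib : ∀ p x y p′ x′ y′ A C D →
            (p + p′) * A + (x + x′) * C + (y + y′) * D ≡ (p * A + x * C + y * D) + (p′ * A + x′ * C + y′ * D)
  distrib = solve-∀

-- The move of replacing the gap c itself: weigh F (pairStat c b) accounts for it, movesOf c omits it.
boundary : (Move → ℕ) → Bool → Bool → ℕ
boundary F true  true  = F dasc⇒peak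
boundary F true  false = F ddes⁺
boundary F false _     = 0

n+0+0≡n : ∀ n → (n + 0) + 0 ≡ n
n+0+0≡n n = trans (ℕ.+-identityʳ (n + 0)) (ℕ.+-identityʳ n)

moveAt-boundary : ∀ F c b h → F (moveAt c b h) + boundary F c b ≡ weigh F (pairStat c b) + boundary F b h
moveAt-boundary F true  true  true  = cong (_+ F dasc⇒peak) (sym (n+0+0≡n (F dasc⇒peak)))
moveAt-boundary F true  true  false = trans (ℕ.+-comm (F ddes⁺) _) (cong (_+ F ddes⁺) (sym (n+0+0≡n (F dasc⇒peak))))
moveAt-boundary F true  false h     =
  trans (ℕ.+-comm (F dasc⁺) (F ddes⁺)) (sym (trans (ℕ.+-identityʳ _) (trans (ℕ.+-identityʳ _) (n+0+0≡n _))))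
moveAt-boundary F false true  true  = ℕ.+-identityʳ (F dasc⇒peak)
moveAt-boundary F false true  false = ℕ.+-identityʳ (F ddes⁺)
moveAt-boundary F false false h     = sym (ℕ.+-identityʳ (F ddes⇒peak + 0))

sum-movesOf : ∀ F c g → sum (map F (movesOf c g)) + boundary F c (next g) ≡ F dasc⁺ + weigh F (framedStat c g)
sum-movesOf F true [] =
  trans (cong (_+ F dasc⇒peak) (ℕ.+-identityʳ (F dasc⁺))) (cong (F dasc⁺ +_) (sym (n+0+0≡n (F dasc⇒peak))))
sum-movesOf F false [] = ℕ.+-identityʳ (F dasc⁺ + 0)
sum-movesOf F c (b ∷ g) =
  trans (rearrange (F (moveAt c b (next g))) (sum (map F (movesOf b g))) (boundary F c b) (weigh F (pairStat c b))
                   (boundary F b (next g)) (F dasc⁺) (weigh F (framedStat b g))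
                   (moveAt-boundary F c b (next g)) (sum-movesOf F b g))
        (cong (F dasc⁺ +_) (sym (weigh-⊕ F (pairStat c b) (framedStat b g))))
  where
  rearrange : ∀ m S c′ P h′ B R → m + c′ ≡ P + h′ → S + h′ ≡ B + R → (m + S) + c′ ≡ B + (P + R)
  rearrange m S c′ P h′ B R local rest = begin
    (m + S) + c′   ≡⟨ ℕ.+-assoc m S c′ ⟩
    m + (S + c′)   ≡⟨ x∙yz≈y∙xz m S c′ ⟩
    S + (m + c′)   ≡⟨ cong (S +_) local ⟩
    S + (P + h′)   ≡⟨ x∙yz≈y∙xz S P h′ ⟩
    P + (S + h′)   ≡⟨ cong (P +_) rest ⟩
    P + (B + R)    ≡⟨ x∙yz≈y∙xz P B R ⟩
    B + (P + R)    ∎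

statSum : ℕ → (Stat → ℕ) → ℕ
statSum n G = sum (map (G ∘ stat) (permWords n))

-- Inserting a new maximum into every position of a word with statistic ⟨ p , x , y ⟩.
Φ : (Stat → ℕ) → Stat → ℕ
Φ G ⟨ p , x , y ⟩ =
  suc p * (G ⟨ p , x , suc y ⟩ + G ⟨ p , suc x , y ⟩) + x * G ⟨ suc p , x ∸ 1 , y ⟩ + y * G ⟨ suc p , x , y ∸ 1 ⟩

Φ-weigh : ∀ G s → G (move ddes⁺ s) + (G (move dasc⁺ s) + weigh (λ d → G (move d s)) s) ≡ Φ G s
Φ-weigh G ⟨ p , x , y ⟩ =
  collect p x y (G ⟨ p , x , suc y ⟩) (G ⟨ p , suc x , y ⟩) (G ⟨ suc p , x ∸ 1 , y ⟩) (G ⟨ suc p , x , y ∸ 1 ⟩)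
  where
  collect : ∀ p x y A B C D → A + (B + (p * (A + B) + x * C + y * D)) ≡ suc p * (A + B) + x * C + y * D
  collect = solve-∀

sum-insertions : ∀ G M x xs → All (_< M) (x ∷ xs) → sum (map (G ∘ stat) (insertions M (x ∷ xs))) ≡ Φ G (stat (x ∷ xs))
sum-insertions G M x xs bounded = begin
  sum (map (G ∘ stat) (insertions M (x ∷ xs)))
    ≡⟨ cong sum (List.map-∘ (insertions M (x ∷ xs))) ⟩
  sum (map (G ∘ framedStat false) (map gaps (insertions M (x ∷ xs))))
    ≡⟨ cong (sum ∘ map (G ∘ framedStat false)) (gaps-insertions M x xs bounded) ⟩
  G (move ddes⁺ s) + sum (map (G ∘ framedStat false) (insertionGaps g))
    ≡⟨ cong (G (move ddes⁺ s) +_) (sum-Moved G (framedStat false) (insertionGaps-Moved false g)) ⟩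
  G (move ddes⁺ s) + sum (map F (movesOf false g))
    ≡⟨ cong (G (move ddes⁺ s) +_) (trans (sym (ℕ.+-identityʳ _)) (sum-movesOf F false g)) ⟩
  G (move ddes⁺ s) + (G (move dasc⁺ s) + weigh F s)
    ≡⟨ Φ-weigh G s ⟩
  Φ G s
    ∎
  where
  g = gaps (x ∷ xs)
  s = stat (x ∷ xs)
  F : Move → ℕ
  F d = G (move d s)

statSum-suc : ∀ n G → statSum (suc (suc n)) G ≡ statSum (suc n) (Φ G)
statSum-suc n G = trans (sum-concatMap (G ∘ stat) (insertions (suc n)) (permWords (suc n)))
                  (sum-map-cong (permWords (suc n)) insert-max)
  where
  insert-max : ∀ {u} → u ∈ permWords (suc n) → sum (map (G ∘ stat) (insertions (suc n) u)) ≡ Φ G (stat u)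
  insert-max {u} u∈ with ∈-permWords⁻ (suc n) u∈
  insert-max {x ∷ xs} u∈ | _ , _ , bounded , _ = sum-insertions G (suc n) x xs bounded

statSum-one : ∀ G → statSum 1 G ≡ G 𝟘
statSum-one G = ℕ.+-identityʳ (G 𝟘)

statSum-cong : ∀ n {G H} → (∀ s → G s ≡ H s) → statSum n G ≡ statSum n H
statSum-cong n G≗H = cong sum (List.map-cong (G≗H ∘ stat) (permWords n))

statSum-+ : ∀ n G H → statSum n (λ s → G s + H s) ≡ statSum n G + statSum n H
statSum-+ n G H = sum-map-+ (G ∘ stat) (H ∘ stat) (permWords n)

-- Valley hopping

∂asc ∂des : (Stat → ℕ) → Stat → ℕ
∂asc G ⟨ p , x , y ⟩ = x * G ⟨ p , x ∸ 1 , y ⟩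
∂des G ⟨ p , x , y ⟩ = y * G ⟨ p , x , y ∸ 1 ⟩

Φ-∂ : ∀ G s → Φ (∂asc G) s + ∂des (Φ G) s ≡ Φ (∂des G) s + ∂asc (Φ G) s
Φ-∂ G ⟨ p , zero , zero ⟩ = identity p (G ⟨ p , 0 , 0 ⟩)
  where
  identity : ∀ (p G : ℕ) → suc p * (0 + 1 * G) + 0 + 0 + 0 ≡ suc p * (1 * G + 0) + 0 + 0 + 0
  identity = solve-∀
Φ-∂ G ⟨ p , zero , suc b ⟩ = identity p b (G ⟨ p , 0 , suc b ⟩) (G ⟨ p , 1 , b ⟩) (G ⟨ suc p , 0 , b ∸ 1 ⟩)
  where
  identity : ∀ (p b G₁ G₂ G₃ : ℕ) →
    suc p * (0 + 1 * G₁) + 0 + suc b * 0 + suc b * (suc p * (G₁ + G₂) + 0 + b * G₃)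
    ≡ suc p * (suc (suc b) * G₁ + suc b * G₂) + 0 + suc b * (b * G₃) + 0
  identity = solve-∀
Φ-∂ G ⟨ p , suc a , zero ⟩ = identity p a (G ⟨ p , a , 1 ⟩) (G ⟨ p , suc a , 0 ⟩) (G ⟨ suc p , a ∸ 1 , 0 ⟩)
  where
  identity : ∀ (p a G₁ G₂ G₃ : ℕ) →
    suc p * (suc a * G₁ + suc (suc a) * G₂) + suc a * (a * G₃) + 0 + 0
    ≡ suc p * (1 * G₂ + 0) + suc a * 0 + 0 + suc a * (suc p * (G₁ + G₂) + a * G₃ + 0)
  identity = solve-∀
Φ-∂ G ⟨ p , suc a , suc b ⟩ =
  identity p a b (G ⟨ p , a , suc (suc b) ⟩) (G ⟨ p , suc a , suc b ⟩) (G ⟨ suc p , a ∸ 1 , suc b ⟩)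
             (G ⟨ suc p , a , b ⟩) (G ⟨ p , suc (suc a) , b ⟩) (G ⟨ suc p , suc a , b ∸ 1 ⟩)
  where
  identity : ∀ (p a b G₁ G₂ G₃ G₄ G₅ G₆ : ℕ) →
    suc p * (suc a * G₁ + suc (suc a) * G₂) + suc a * (a * G₃) + suc b * (suc a * G₄)
      + suc b * (suc p * (G₂ + G₅) + suc a * G₄ + b * G₆)
    ≡ suc p * (suc (suc b) * G₂ + suc b * G₅) + suc a * (suc b * G₄) + suc b * (b * G₆)
      + suc a * (suc p * (G₁ + G₂) + a * G₃ + suc b * G₄)
  identity = solve-∀

statSum-∂asc≡∂des : ∀ n G → statSum (suc n) (∂asc G) ≡ statSum (suc n) (∂des G)
statSum-∂asc≡∂des zero G = trans (statSum-one (∂asc G)) (sym (statSum-one (∂des G)))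
statSum-∂asc≡∂des (suc n) G = begin
  statSum (suc (suc n)) (∂asc G)   ≡⟨ statSum-suc n (∂asc G) ⟩
  S (Φ (∂asc G))                   ≡⟨ ℕ.+-cancelʳ-≡ _ _ _ swapped ⟩
  S (Φ (∂des G))                   ≡⟨ statSum-suc n (∂des G) ⟨
  statSum (suc (suc n)) (∂des G)   ∎
  where
  S = statSum (suc n)
  swapped : S (Φ (∂asc G)) + S (∂des (Φ G)) ≡ S (Φ (∂des G)) + S (∂des (Φ G))
  swapped = begin
    S (Φ (∂asc G)) + S (∂des (Φ G))           ≡⟨ statSum-+ (suc n) (Φ (∂asc G)) (∂des (Φ G)) ⟨
    S (λ s → Φ (∂asc G) s + ∂des (Φ G) s)     ≡⟨ statSum-cong (suc n) (Φ-∂ G) ⟩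
    S (λ s → Φ (∂des G) s + ∂asc (Φ G) s)     ≡⟨ statSum-+ (suc n) (Φ (∂des G)) (∂asc (Φ G)) ⟩
    S (Φ (∂des G)) + S (∂asc (Φ G))           ≡⟨ cong (S (Φ (∂des G)) +_) (statSum-∂asc≡∂des n (Φ G)) ⟩
    S (Φ (∂des G)) + S (∂des (Φ G))           ∎

byTotal : (ℕ → ℕ → ℕ) → Stat → ℕ
byTotal φ ⟨ p , x , y ⟩ = φ p (x + y)

ascentFree : (ℕ → ℕ → ℕ) → Stat → ℕ
ascentFree φ ⟨ p , zero , y ⟩ = 2 ^ y * φ p y
ascentFree φ ⟨ p , suc _ , _ ⟩ = 0

-- Φ acting on functions of (peaks, double ascents + double descents).
Ψ : (ℕ → ℕ → ℕ) → ℕ → ℕ → ℕ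
Ψ φ p m = 2 * suc p * φ p (suc m) + m * φ (suc p) (m ∸ 1)

Φ-byTotal : ∀ φ s → Φ (byTotal φ) s ≡ byTotal (Ψ φ) s
Φ-byTotal φ ⟨ p , x , y ⟩ = begin
  suc p * (φ p (x + suc y) + φ p (suc x + y)) + x * φ (suc p) (x ∸ 1 + y) + y * φ (suc p) (x + (y ∸ 1))
    ≡⟨ cong₂ (λ t u → suc p * (φ p t + φ p (suc x + y)) + u + y * φ (suc p) (x + (y ∸ 1)))
             (ℕ.+-suc x y) (pred-left x) ⟩
  suc p * (A + A) + x * B + y * φ (suc p) (x + (y ∸ 1))
    ≡⟨ cong (λ u → suc p * (A + A) + x * B + u) (pred-right y) ⟩
  suc p * (A + A) + x * B + y * B
    ≡⟨ collect p x y A B ⟩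
  2 * suc p * A + (x + y) * B
    ∎
  where
  A = φ p (suc (x + y))
  B = φ (suc p) (x + y ∸ 1)
  pred-left : ∀ x → x * φ (suc p) (x ∸ 1 + y) ≡ x * φ (suc p) (x + y ∸ 1)
  pred-left zero = refl
  pred-left (suc a) = refl
  pred-right : ∀ y → y * φ (suc p) (x + (y ∸ 1)) ≡ y * φ (suc p) (x + y ∸ 1)
  pred-right zero = refl
  pred-right (suc b) = cong (λ t → suc b * φ (suc p) (t ∸ 1)) (sym (ℕ.+-suc x b))
  collect : ∀ p x y A B → suc p * (A + A) + x * B + y * B ≡ 2 * suc p * A + (x + y) * B
  collect = solve-∀

raise : (Stat → ℕ) → Stat → ℕ
raise G ⟨ p , x , y ⟩ = G ⟨ suc p , x , y ⟩

newDescent : (ℕ → ℕ → ℕ) → Stat → ℕ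
newDescent φ ⟨ p , x , y ⟩ = suc p * ascentFree φ ⟨ p , x , suc y ⟩

Φ-ascentFree : ∀ φ s → Φ (ascentFree φ) s ≡ newDescent φ s + ∂asc (raise (ascentFree φ)) s + ∂des (raise (ascentFree φ)) s
Φ-ascentFree φ ⟨ p , x , y ⟩ =
  cong (λ t → suc p * t + x * ascentFree φ ⟨ suc p , x ∸ 1 , y ⟩ + y * ascentFree φ ⟨ suc p , x , y ∸ 1 ⟩)
       (ℕ.+-identityʳ (ascentFree φ ⟨ p , x , suc y ⟩))

ascentFree-Ψ : ∀ φ s → ascentFree (Ψ φ) s ≡ newDescent φ s + ∂des (raise (ascentFree φ)) s + ∂des (raise (ascentFree φ)) s
ascentFree-Ψ φ ⟨ p , suc x , y ⟩ rewrite ℕ.*-zeroʳ p | ℕ.*-zeroʳ y = refl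
ascentFree-Ψ φ ⟨ p , zero , zero ⟩ = identity p (φ p 1)
  where
  identity : ∀ (p A : ℕ) → 1 * (2 * suc p * A + 0) ≡ suc p * (2 * 1 * A) + 0 + 0
  identity = solve-∀
ascentFree-Ψ φ ⟨ p , zero , suc b ⟩ = identity p b (2 ^ b) (φ p (suc (suc b))) (φ (suc p) b)
  where
  identity : ∀ (p b Q A B : ℕ) →
    (2 * Q) * (2 * suc p * A + suc b * B) ≡ suc p * ((2 * (2 * Q)) * A) + suc b * (Q * B) + suc b * (Q * B)
  identity = solve-∀

-- 2 ^ y = 2 * 2 ^ (y ∸ 1) splits the descent term of Ψ in two, and statSum-∂asc≡∂des turns one half into the ascent term.
valley-hopping : ∀ n φ → statSum (suc n) (byTotal φ) ≡ statSum (suc n) (ascentFree φ)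
valley-hopping zero φ = trans (statSum-one (byTotal φ)) (sym (trans (statSum-one (ascentFree φ)) (ℕ.+-identityʳ (φ 0 0))))
valley-hopping (suc n) φ = begin
  statSum (suc (suc n)) (byTotal φ)     ≡⟨ statSum-suc n (byTotal φ) ⟩
  S (Φ (byTotal φ))                     ≡⟨ statSum-cong (suc n) (Φ-byTotal φ) ⟩
  S (byTotal (Ψ φ))                     ≡⟨ valley-hopping n (Ψ φ) ⟩
  S (ascentFree (Ψ φ))                  ≡⟨ statSum-cong (suc n) (ascentFree-Ψ φ) ⟩
  S (λ s → N s + D s + D s)             ≡⟨ statSum-+ (suc n) (λ s → N s + D s) D ⟩
  S (λ s → N s + D s) + S D             ≡⟨ cong (_+ S D) (statSum-+ (suc n) N D) ⟩
  S N + S D + S D                       ≡⟨ cong (λ t → S N + t + S D) (statSum-∂asc≡∂des n (raise (ascentFree φ))) ⟨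
  S N + S A + S D                       ≡⟨ cong (_+ S D) (statSum-+ (suc n) N A) ⟨
  S (λ s → N s + A s) + S D             ≡⟨ statSum-+ (suc n) (λ s → N s + A s) D ⟨
  S (λ s → N s + A s + D s)             ≡⟨ statSum-cong (suc n) (Φ-ascentFree φ) ⟨
  S (Φ (ascentFree φ))                  ≡⟨ statSum-suc n (ascentFree φ) ⟨
  statSum (suc (suc n)) (ascentFree φ)  ∎
  where
  S = statSum (suc n)
  N A D : Stat → ℕ
  N = newDescent φ
  A = ∂asc (raise (ascentFree φ))
  D = ∂des (raise (ascentFree φ))

statSum-const : ∀ n → statSum n (λ _ → 1) ≡ n !
statSum-const n = trans (sum-map-const 1 (permWords n)) (trans (ℕ.*-identityˡ _) (length-permWords n))

statOfGaps : List Bool → Stat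
statOfGaps [] = 𝟘
statOfGaps (g ∷ gs) = gapStat g gs

flip-< : ∀ {a b} → a ≢ b → does (b <? a) ≡ not (does (a <? b))
flip-< {a} {b} a≢b with ℕ.<-cmp a b
... | tri< a<b _ _ rewrite dec-true (a <? b) a<b | dec-false (b <? a) (ℕ.<-asym a<b) = refl
... | tri≈ _ a≡b _ = ⊥-elim (a≢b a≡b)
... | tri> _ _ b<a rewrite dec-false (a <? b) (ℕ.<-asym b<a) | dec-true (b <? a) b<a = refl

doubleDescents-windows : ∀ s → Linked _≢_ s → doubleDescents (windows s) ≡ ddes (statOfGaps (gaps s))
doubleDescents-windows [] _ = refl
doubleDescents-windows (a ∷ []) _ = refl
doubleDescents-windows (a ∷ b ∷ []) _ = refl
doubleDescents-windows (a ∷ b ∷ c ∷ r) (a≢b ∷ linked@(b≢c ∷ _)) =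
  cong₂ _+_ (trans (cong₂ (λ u v → if u ∧ v then 1 else 0) (flip-< a≢b) (flip-< b≢c))
                   (descent-pair (does (a <? b)) (does (b <? c))))
            (doubleDescents-windows (b ∷ c ∷ r) linked)
  where
  descent-pair : ∀ g h → (if not g ∧ not h then 1 else 0) ≡ ddes (pairStat g h)
  descent-pair true  true  = refl
  descent-pair true  false = refl
  descent-pair false true  = refl
  descent-pair false false = refl

noDoubleAscent-windows : ∀ s → noDoubleAscent (windows s) ≡ (dasc (statOfGaps (gaps s)) ≡ᵇ 0)
noDoubleAscent-windows [] = refl
noDoubleAscent-windows (a ∷ []) = refl
noDoubleAscent-windows (a ∷ b ∷ []) = refl
noDoubleAscent-windows (a ∷ b ∷ c ∷ r) =
  trans (cong (not (does (a <? b) ∧ does (b <? c)) ∧_) (noDoubleAscent-windows (b ∷ c ∷ r)))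
        (ascent-pair (does (a <? b)) (does (b <? c)) (dasc (statOfGaps (gaps (b ∷ c ∷ r)))))
  where
  ascent-pair : ∀ g h X → not (g ∧ h) ∧ (X ≡ᵇ 0) ≡ ((dasc (pairStat g h) + X) ≡ᵇ 0)
  ascent-pair true  true  X = refl
  ascent-pair true  false X = refl
  ascent-pair false true  X = refl
  ascent-pair false false X = refl

gaps-framed : ∀ M x xs → All (_< M) (x ∷ xs) → gaps (M ∷ (x ∷ xs) ++ [ M ]) ≡ false ∷ gaps (x ∷ xs) ++ [ true ]
gaps-framed M x xs (x<M ∷ bounded) = cong₂ _∷_ (dec-false (M <? x) (ℕ.<-asym x<M)) (gaps-snoc x xs (x<M ∷ bounded))
  where
  gaps-snoc : ∀ x xs → All (_< M) (x ∷ xs) → gaps ((x ∷ xs) ++ [ M ]) ≡ gaps (x ∷ xs) ++ [ true ]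
  gaps-snoc x [] (x<M ∷ []) = cong [_] (dec-true (x <? M) x<M)
  gaps-snoc x (y ∷ r) (_ ∷ bounded) = cong (does (x <? y) ∷_) (gaps-snoc y r bounded)

Linked-framed : ∀ M x xs → All (_< M) (x ∷ xs) → Linked _≢_ (x ∷ xs) → Linked _≢_ (M ∷ (x ∷ xs) ++ [ M ])
Linked-framed M x xs bounded@(x<M ∷ _) linked = (λ M≡x → ℕ.<-irrefl (sym M≡x) x<M) ∷ Linked-snoc x xs bounded linked
  where
  Linked-snoc : ∀ x xs → All (_< M) (x ∷ xs) → Linked _≢_ (x ∷ xs) → Linked _≢_ ((x ∷ xs) ++ [ M ])
  Linked-snoc x [] (x<M ∷ []) _ = (λ x≡M → ℕ.<-irrefl x≡M x<M) ∷ [-]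
  Linked-snoc x (y ∷ r) (_ ∷ bounded) (x≢y ∷ linked) = x≢y ∷ Linked-snoc y r bounded linked

framedWeight≡ascentFree : ∀ M x xs → All (_< M) (x ∷ xs) → Unique (x ∷ xs) →
                          framedWeight M (x ∷ xs) ≡ ascentFree (λ _ _ → 1) (stat (x ∷ xs))
framedWeight≡ascentFree M x xs bounded unique = begin
  weight (windows framed)                 ≡⟨ cong₂ (λ b k → if b then 2 ^ k else 0) (noDoubleAscent-windows framed)
                                                   (doubleDescents-windows framed (Linked-framed M x xs bounded (AllPairs⇒Linked unique))) ⟩
  weightOf (statOfGaps (gaps framed))     ≡⟨ cong (weightOf ∘ statOfGaps) (gaps-framed M x xs bounded) ⟩
  weightOf (stat (x ∷ xs))                ≡⟨ ascent-free (stat (x ∷ xs)) ⟩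
  ascentFree (λ _ _ → 1) (stat (x ∷ xs))  ∎
  where
  framed = M ∷ (x ∷ xs) ++ [ M ]
  weightOf : Stat → ℕ
  weightOf s = if dasc s ≡ᵇ 0 then 2 ^ ddes s else 0
  ascent-free : ∀ s → weightOf s ≡ ascentFree (λ _ _ → 1) s
  ascent-free ⟨ p , zero , y ⟩ = sym (ℕ.*-identityʳ (2 ^ y))
  ascent-free ⟨ p , suc x , y ⟩ = refl

-- Rotation

-- The summand of cycSum, read off the word of π.
cycTerm : ℕ → List ℕ → ℕ
cycTerm n u = if does (permWord? n u) then cyclicWeight u else 0

cycTerm-¬PermWord : ∀ {n u} → ¬ PermWord n u → cycTerm n u ≡ 0
cycTerm-¬PermWord {n} {u} ¬pw = cong (λ b → if b then cyclicWeight u else 0) (dec-false (permWord? n u) ¬pw)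

cycSum≡sum-words : ∀ p → let n = suc (suc p) in cycSum n ≡ sum (map (cycTerm n) (words n n))
cycSum≡sum-words p = begin
  cycSum n
    ≡⟨ sum-map-filter cyc123Avoiding? (λ π → 2 ^ bbc π) (perms n) ⟩
  sum (map (λ π → if does (cyc123Avoiding? π) then 2 ^ bbc π else 0) (filter isPerm? (allFuns n n)))
    ≡⟨ sum-map-filter isPerm? _ (allFuns n n) ⟩
  sum (map (λ π → if does (isPerm? π) then (if does (cyc123Avoiding? π) then 2 ^ bbc π else 0) else 0) (allFuns n n))
    ≡⟨ cong sum (List.map-cong term≡ (allFuns n n)) ⟩
  sum (map (cycTerm n ∘ wordOf) (allFuns n n))
    ≡⟨ cong sum (List.map-∘ (allFuns n n)) ⟩
  sum (map (cycTerm n) (map wordOf (allFuns n n)))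
    ≡⟨ cong (sum ∘ map (cycTerm n)) (map-wordOf-allFuns n n) ⟩
  sum (map (cycTerm n) (words n n))
    ∎
  where
  n = suc (suc p)
  term≡ : ∀ π → (if does (isPerm? π) then (if does (cyc123Avoiding? π) then 2 ^ bbc π else 0) else 0) ≡ cycTerm n (wordOf π)
  term≡ π = if-does-cong (isPerm? π) (permWord? n (wordOf π)) (mk⇔ (IsPerm⇒PermWord π) (PermWord⇒IsPerm π))
                         (λ _ → cyclicWeight-wordOf π)

PermWord-rotate : ∀ {n} u → PermWord n (rotate u) ⇔ PermWord n u
PermWord-rotate [] = mk⇔ (λ p → p) (λ p → p)
PermWord-rotate (a ∷ r) = mk⇔ (PermWord-resp-↭ (↭.++-comm r [ a ])) (PermWord-resp-↭ (↭.++-comm [ a ] r))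

cycTerm-rotate : ∀ n u → cycTerm n (rotate u) ≡ cycTerm n u
cycTerm-rotate n u = if-does-cong (permWord? n (rotate u)) (permWord? n u) (PermWord-rotate u) (λ _ → cyclicWeight-rotate u)

rotate-injective : ∀ {u v} → rotate u ≡ rotate v → u ≡ v
rotate-injective {[]} {[]} _ = refl
rotate-injective {[]} {a ∷ []} ()
rotate-injective {[]} {a ∷ _ ∷ _} ()
rotate-injective {a ∷ []} {[]} ()
rotate-injective {a ∷ _ ∷ _} {[]} ()
rotate-injective {a ∷ r} {a′ ∷ r′} eq with List.∷ʳ-injective r r′ eq
... | refl , refl = refl

∈-words-↭ : ∀ k m {u v} → u ↭ v → u ∈ words k m → v ∈ words k m
∈-words-↭ k m u↭v u∈ with ∈-words⁻ k m u∈
... | len , bounded = ∈-words⁺ k m (trans (sym (↭.xs↭ys⇒|xs|≡|ys| u↭v)) len) (↭.All-resp-↭ (resp (_< m)) u↭v bounded)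

∈-words-rotate⁺ : ∀ k m u → u ∈ words k m → rotate u ∈ words k m
∈-words-rotate⁺ k m [] u∈ = u∈
∈-words-rotate⁺ k m (a ∷ r) = ∈-words-↭ k m (↭.++-comm [ a ] r)

∈-words-rotate⁻ : ∀ k m {v} → v ∈ words k m → v ∈ map rotate (words k m)
∈-words-rotate⁻ k m {[]} v∈ = ∈.∈-map⁺ rotate v∈
∈-words-rotate⁻ k m {x ∷ xs} v∈ with ∷-∷ʳ-view x xs
... | u , z , eq = subst (_∈ map rotate (words k m)) (sym eq)
                         (∈.∈-map⁺ rotate (∈-words-↭ k m (↭.++-comm u [ z ]) (subst (_∈ words k m) eq v∈)))

sum-words-rotate : ∀ k m (F : List ℕ → ℕ) → sum (map (F ∘ rotate) (words k m)) ≡ sum (map F (words k m))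
sum-words-rotate k m F = trans (cong sum (List.map-∘ (words k m)))
  (sum-map-unique (Unique.map⁺ rotate-injective (words-unique k m)) (words-unique k m)
                  (λ v∈ → let u , u∈ , v≡ = ∈.∈-map⁻ rotate v∈ in
                          subst (_∈ words k m) (sym v≡) (∈-words-rotate⁺ k m u u∈))
                  (∈-words-rotate⁻ k m) F)

isAt : ℕ → ℕ → List ℕ → Bool
isAt M j [] = false
isAt M zero (x ∷ _) = does (x ≟ M)
isAt M (suc j) (_ ∷ xs) = isAt M j xs

isAt-snoc : ∀ M j a r → j < length r → isAt M j (r ∷ʳ a) ≡ isAt M j r
isAt-snoc M zero a (x ∷ r) _ = refl
isAt-snoc M (suc j) a (x ∷ r) (s≤s j<) = isAt-snoc M j a r j<

sum-isAt-∉ : ∀ M u c → M ∉ u → sum (applyUpTo (λ j → if isAt M j u then c else 0) (length u)) ≡ 0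
sum-isAt-∉ M [] c _ = refl
sum-isAt-∉ M (x ∷ xs) c M∉ rewrite dec-false (x ≟ M) (λ x≡M → M∉ (here (sym x≡M))) = sum-isAt-∉ M xs c (M∉ ∘ there)

sum-isAt-unique : ∀ M u c → Unique u → M ∈ u → sum (applyUpTo (λ j → if isAt M j u then c else 0) (length u)) ≡ c
sum-isAt-unique M (x ∷ xs) c (x∉ ∷ _) (here refl) rewrite dec-true (M ≟ M) refl =
  trans (cong (c +_) (sum-isAt-∉ M xs c (λ M∈ → All.lookup x∉ M∈ refl))) (ℕ.+-identityʳ c)
sum-isAt-unique M (x ∷ xs) c (x∉ ∷ xs!) (there M∈) rewrite dec-false (x ≟ M) (All.lookup x∉ M∈) =
  sum-isAt-unique M xs c xs! M∈

-- Mark the position j of the maximum M; rotating moves the mark and preserves cycTerm.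
module Marking (M : ℕ) where

  private
    n = suc M

  mark : ℕ → List ℕ → ℕ
  mark j u = if isAt M j u then cycTerm n u else 0

  marked : ℕ → ℕ
  marked j = sum (map (mark j) (words n n))

  cycTerm≡sum-marks : ∀ {u} → u ∈ words n n → cycTerm n u ≡ sum (map (λ j → mark j u) (upTo n))
  cycTerm≡sum-marks {u} _ = by-cases (permWord? n u)
    where
    by-cases : Dec (PermWord n u) → cycTerm n u ≡ sum (map (λ j → mark j u) (upTo n))
    by-cases (yes (u! , len , _ , covers)) = let M∈u = All.lookup covers (∈.∈-upTo⁺ (ℕ.n<1+n M)) in sym (begin
      sum (map (λ j → mark j u) (upTo n))            ≡⟨ cong sum (List.map-upTo (λ j → mark j u) n) ⟩
      sum (applyUpTo (λ j → mark j u) n)             ≡⟨ cong (sum ∘ applyUpTo (λ j → mark j u)) len ⟨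
      sum (applyUpTo (λ j → mark j u) (length u))    ≡⟨ sum-isAt-unique M u (cycTerm n u) u! M∈u ⟩
      cycTerm n u                                    ∎)
    by-cases (no ¬pw) = trans (cycTerm-¬PermWord ¬pw) (sym (sum-map-zero (upTo n) (λ {j} _ → unmarked (isAt M j u))))
      where
      unmarked : ∀ b → (if b then cycTerm n u else 0) ≡ 0
      unmarked true = cycTerm-¬PermWord ¬pw
      unmarked false = refl

  marked-suc : ∀ j → suc j < n → marked (suc j) ≡ marked j
  marked-suc j sj<n = trans (sum-map-cong (words n n) shift) (sum-words-rotate n n (mark j))
    where
    shift : ∀ {u} → u ∈ words n n → mark (suc j) u ≡ mark j (rotate u)
    shift {u} u∈ with ∈-words⁻ n n u∈
    shift {a ∷ r} u∈ | len , _ =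
      sym (cong₂ (λ b t → if b then t else 0) (isAt-snoc M j a r (ℕ.≤-pred (subst (suc (suc j) ≤_) (sym len) sj<n)))
                                              (cycTerm-rotate n (a ∷ r)))

  marked-constant : ∀ j → j < n → marked j ≡ marked 0
  marked-constant zero _ = refl
  marked-constant (suc j) sj<n = trans (marked-suc j sj<n) (marked-constant j (ℕ.<-trans (ℕ.n<1+n j) sj<n))

  marked-first : marked 0 ≡ sum (map (λ u → cycTerm n (M ∷ u)) (words M n))
  marked-first = begin
    marked 0
      ≡⟨ sum-concatMap (mark 0) (λ a → map (a ∷_) (words M n)) (upTo n) ⟩
    sum (map (λ a → sum (map (mark 0) (map (a ∷_) (words M n)))) (upTo n))
      ≡⟨ cong sum (List.map-cong (λ a → trans (cong sum (sym (List.map-∘ (words M n))))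
                                              (sum-map-if (does (a ≟ M)) _ (words M n))) (upTo n)) ⟩
    sum (map (λ a → if does (a ≟ M) then sum (map (λ u → cycTerm n (a ∷ u)) (words M n)) else 0) (upTo n))
      ≡⟨ sum-upTo-select (λ a → sum (map (λ u → cycTerm n (a ∷ u)) (words M n))) M ⟩
    sum (map (λ u → cycTerm n (M ∷ u)) (words M n))
      ∎

  sum-words-by-rotation : sum (map (cycTerm n) (words n n)) ≡ n * sum (map (λ u → cycTerm n (M ∷ u)) (words M n))
  sum-words-by-rotation = begin
    sum (map (cycTerm n) (words n n))
      ≡⟨ sum-map-cong (words n n) cycTerm≡sum-marks ⟩
    sum (map (λ u → sum (map (λ j → mark j u) (upTo n))) (words n n))
      ≡⟨ sum-map-swap (λ u j → mark j u) (words n n) (upTo n) ⟩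
    sum (map marked (upTo n))
      ≡⟨ sum-map-cong (upTo n) (λ j∈ → marked-constant _ (∈.∈-upTo⁻ j∈)) ⟩
    sum (map (λ _ → marked 0) (upTo n))
      ≡⟨ sum-map-const (marked 0) (upTo n) ⟩
    marked 0 * length (upTo n)
      ≡⟨ cong₂ _*_ marked-first (List.length-upTo n) ⟩
    sum (map (λ u → cycTerm n (M ∷ u)) (words M n)) * n
      ≡⟨ ℕ.*-comm _ n ⟩
    n * sum (map (λ u → cycTerm n (M ∷ u)) (words M n))
      ∎

sum-max-first : ∀ p → let M = suc p in
                sum (map (λ u → cycTerm (suc M) (M ∷ u)) (words M (suc M))) ≡ statSum M (ascentFree (λ _ _ → 1))
sum-max-first p = begin
  sum (map (λ u → cycTerm (suc M) (M ∷ u)) (words M (suc M)))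
    ≡⟨ sum-map-cong (words M (suc M)) (λ {u} _ → drop-max u) ⟩
  sum (map (λ u → if does (permWord? M u) then framedWeight M u else 0) (words M (suc M)))
    ≡⟨ sum-map-filter (permWord? M) (framedWeight M) (words M (suc M)) ⟨
  sum (map (framedWeight M) (filter (permWord? M) (words M (suc M))))
    ≡⟨ sum-map-unique (Unique.filter⁺ (permWord? M) (words-unique M (suc M))) (permWords-unique M)
                      (λ u∈ → ∈-permWords⁺ M (proj₂ (∈.∈-filter⁻ (permWord? M) {xs = words M (suc M)} u∈)))
                      (λ u∈ → let pw@(_ , len , bounded , _) = ∈-permWords⁻ M u∈ in
                              ∈.∈-filter⁺ (permWord? M) (∈-words⁺ M (suc M) len (All.map ℕ.m≤n⇒m≤1+n bounded)) pw)
                      (framedWeight M) ⟩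
  sum (map (framedWeight M) (permWords M))
    ≡⟨ sum-map-cong (permWords M) (λ u∈ → framed (∈-permWords⁻ M u∈)) ⟩
  statSum M (ascentFree (λ _ _ → 1))
    ∎
  where
  M = suc p
  -- A PermWord of length M = suc p is nonempty.
  framed : ∀ {u} → PermWord M u → framedWeight M u ≡ ascentFree (λ _ _ → 1) (stat u)
  framed {x ∷ xs} (unique , _ , bounded , _) = framedWeight≡ascentFree M x xs bounded unique
  drop-max : ∀ u → cycTerm (suc M) (M ∷ u) ≡ (if does (permWord? M u) then framedWeight M u else 0)
  drop-max u = if-does-cong (permWord? (suc M) (M ∷ u)) (permWord? M u) (mk⇔ PermWord-∷⁻ PermWord-∷⁺)
                            (max-first u ∘ PermWord-∷⁻)
    where
    max-first : ∀ u → PermWord M u → cyclicWeight (M ∷ u) ≡ framedWeight M u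
    max-first (x ∷ xs) (_ , _ , bounded , _) = cyclicWeight-max-first M x xs bounded

theorem3p4 : (m : ℕ) → cycSum (suc m) ≡ (suc m) !
theorem3p4 zero = refl
theorem3p4 (suc p) = begin
  cycSum n                                                      ≡⟨ cycSum≡sum-words p ⟩
  sum (map (cycTerm n) (words n n))                             ≡⟨ Marking.sum-words-by-rotation M ⟩
  n * sum (map (λ u → cycTerm n (M ∷ u)) (words M n))           ≡⟨ cong (n *_) (sum-max-first p) ⟩
  n * statSum M (ascentFree (λ _ _ → 1))                              ≡⟨ cong (n *_) (valley-hopping p (λ _ _ → 1)) ⟨
  n * statSum M (byTotal (λ _ _ → 1))                                 ≡⟨ cong (n *_) (statSum-const M) ⟩
  n * M !                                                       ∎
  where
  M = suc p
  n = suc M
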